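{- Let $G$ be a locally linear graph and let $G^*$ be its triangle graph. Then the number of induced subgraphs of $G$ isomorphic to the cycle $C_5$ equals the number of induced subgraphs of $G^*$ isomorphic to $C_5$.
   Context: All graphs are finite, simple and undirected. A graph $G$ is locally linear if it has no isolated vertices and for every vertex $v$ the subgraph induced on its neighbourhood $N(v)=\{w\in V(G): w\sim v, w\neq v\}$ is $1$-regular; equivalently, every edge of $G$ lies in exactly one triangle (so two distinct triangles of $G$ share at most one vertex). The triangle graph $G^*$ of a locally linear graph $G$ is the graph whose vertex set is the set of triangles of $G$, two distinct triangles being adjacent in $G^*$ if and only if they share a common vertex in $G$. -}

module Defs where

open import Data.Nat using (ℕ; zero; suc)
open import Data.Bool using (Bool; true; false; _∧_; _∨_; not; T?)
open import Data.Bool.ListAction using (any)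
open import Data.Fin using (Fin)
open import Data.Fin.Properties using () renaming (_≟_ to _≟F_)
open import Data.List using (List; []; _∷_; map; _++_; concatMap; filter; length; allFin)
open import Data.List.Properties using (≡-dec)
open import Data.Product using (Σ; ∃; _×_; _,_)
open import Relation.Nullary using (¬_)
open import Relation.Nullary.Decidable using (⌊_⌋; does)
open import Relation.Binary.PropositionalEquality using (_≡_)

record Graph (n : ℕ) : Set where
  field
    adj    : Fin n → Fin n → Bool
    sym    : ∀ u v → adj u v ≡ adj v u
    irrefl : ∀ v → adj v v ≡ false
open Graph public

LocallyLinear : ∀ {n} → Graph n → Set
LocallyLinear {n} G =
  (∀ v → ∃ λ u → adj G v u ≡ true) ×
  (∀ u v → adj G u v ≡ true →
     ∃ λ w → (adj G u w ≡ true × adj G v w ≡ true) ×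
             (∀ w' → adj G u w' ≡ true → adj G v w' ≡ true → w' ≡ w))

choose : ∀ {A : Set} → ℕ → List A → List (List A)
choose zero    _        = [] ∷ []
choose (suc k) []       = []
choose (suc k) (x ∷ xs) = map (x ∷_) (choose k xs) ++ choose (suc k) xs

insertions : ∀ {A : Set} → A → List A → List (List A)
insertions x []       = (x ∷ []) ∷ []
insertions x (y ∷ ys) = (x ∷ y ∷ ys) ∷ map (y ∷_) (insertions x ys)

perms : ∀ {A : Set} → List A → List (List A)
perms []       = [] ∷ []
perms (x ∷ xs) = concatMap (insertions x) (perms xs)

-- The ordering (a,b,c,d,e) is an isomorphism from C5 (0-1-2-3-4-0) onto the
-- induced subgraph on {a,b,c,d,e}: consecutive pairs adjacent, others not.
isInducedC5Order : ∀ {A : Set} → (A → A → Bool) → List A → Bool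
isInducedC5Order adj (a ∷ b ∷ c ∷ d ∷ e ∷ []) =
  adj a b ∧ adj b c ∧ adj c d ∧ adj d e ∧ adj e a ∧
  not (adj a c) ∧ not (adj a d) ∧ not (adj b d) ∧ not (adj b e) ∧ not (adj c e)
isInducedC5Order adj _ = false

inducesC5 : ∀ {A : Set} → (A → A → Bool) → List A → Bool
inducesC5 adj S = any (isInducedC5Order adj) (perms S)

-- Number of induced subgraphs isomorphic to C5, for a graph given by a
-- duplicate-free list of its vertices and a (symmetric, irreflexive) adjacency.
countInducedC5 : ∀ {A : Set} → List A → (A → A → Bool) → ℕ
countInducedC5 vs adj = length (filter (λ S → T? (inducesC5 adj S)) (choose 5 vs))

-- Triangles of G: 3-element vertex sets (as increasing lists) that are pairwise adjacent.
isTriangle : ∀ {n} → Graph n → List (Fin n) → Bool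
isTriangle G (a ∷ b ∷ c ∷ []) = adj G a b ∧ adj G b c ∧ adj G a c
isTriangle G _ = false

triangles : ∀ {n} → Graph n → List (List (Fin n))
triangles {n} G = filter (λ t → T? (isTriangle G t)) (choose 3 (allFin n))

shareVertex : ∀ {n} → List (Fin n) → List (Fin n) → Bool
shareVertex [] s = false
shareVertex (x ∷ t) s = any (λ y → ⌊ x ≟F y ⌋) s ∨ shareVertex t s

triAdj : ∀ {n} → List (Fin n) → List (Fin n) → Bool
triAdj t s = not ⌊ ≡-dec _≟F_ t s ⌋ ∧ shareVertex t s

{-# OPTIONS --safe --with-K #-}
module Submission where

-- An induced pentagon abcde of G gives the pentagon of the triangles on its
-- edges ab, bc, cd, de, ea. Consecutive ones share a vertex, and a
-- vertex shared by two non-consecutive ones would put some edge of G into two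
-- triangles, so this pentagon is induced in G*. Conversely, consecutive
-- triangles of an induced pentagon of G* meet in exactly one vertex (two
-- triangles share at most one vertex), and these five vertices form an induced
-- pentagon of G. On vertex sets the two constructions are
--   S  ↦ the triangles containing two vertices of S,
--   S* ↦ the vertices lying on two triangles of S*,
-- and they are mutually inverse, so both counts are equal.
--
-- Vertex sets are sublists of allFin n and triangle sets are sublists of
-- triangles G, so two of them with the same elements are equal lists (∼set⇒≡).

open import Data.Bool using (Bool; true; false; _∧_; _∨_; not; T?)
open import Data.Bool.ListAction using (any)
open import Data.Bool.Properties using (T-≡; ∨-zeroʳ; ⇔→≡; ¬-not) renaming (_≟_ to _≟B_)
open import Data.Empty using (⊥)
open import Data.Fin using (Fin)
open import Data.Fin.Properties using () renaming (_≟_ to _≟F_)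
open import Data.List using (List; []; _∷_; _++_; map; filter; length; allFin)
open import Data.List.Properties using (length-map; ∷-injectiveʳ; ≡-dec)
open import Data.List.Membership.Propositional using (_∈_; find; lose)
open import Data.List.Membership.Propositional.Properties
  using (∈-allFin; ∈-map⁺; ∈-map⁻; ∈-++⁺ˡ; ∈-++⁺ʳ; ∈-++⁻; ∈-∃++; ∈-concatMap⁺; ∈-concatMap⁻; ∈-filter⁺; ∈-filter⁻)
open import Data.List.Membership.Propositional.Properties.WithK using (unique∧set⇒bag)
import Data.List.Membership.DecPropositional as DecMembership
open import Data.List.Relation.Unary.All using (All; []; _∷_)
import Data.List.Relation.Unary.All as All
open import Data.List.Relation.Unary.All.Properties using (All¬⇒¬Any) renaming (map⁺ to All-map⁺)
open import Data.List.Relation.Unary.Any using (Any; here; there; any?)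
import Data.List.Relation.Unary.Any as Any
open import Data.List.Relation.Unary.Any.Properties using (any⁺; any⁻)
open import Data.List.Relation.Unary.Unique.Propositional using (Unique; []; _∷_)
import Data.List.Relation.Unary.Unique.Propositional.Properties as Unique
open import Data.List.Relation.Binary.Sublist.Propositional using (_⊆_; []; _∷_; _∷ʳ_; minimum; lookup)
open import Data.List.Relation.Binary.Sublist.Propositional.Properties using (All-resp-⊆; filter-⊆)
open import Data.List.Relation.Binary.Permutation.Propositional using (_↭_; refl; prep; swap; trans; ↭-sym)
open import Data.List.Relation.Binary.Permutation.Propositional.Properties
  using (↭-length; ↭-empty-inv; ∈-resp-↭; drop-mid)
open import Data.List.Relation.Binary.BagAndSetEquality using (_∼[_]_; set; [_]-Equality; ∼bag⇒↭)
open import Data.Nat using (ℕ; zero; suc)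
open import Data.Product using (∃; ∃₂; _×_; _,_; proj₁; proj₂)
open import Data.Sum using (_⊎_; inj₁; inj₂)
open import Function using (_∘_)
open import Function.Bundles using (Equivalence; mk⇔)
open import Relation.Binary.Definitions using (DecidableEquality)
open import Relation.Binary.PropositionalEquality using (_≡_; _≢_; refl; sym; cong; subst; ≢-sym)
  renaming (trans to ≡-trans)
import Relation.Binary.Reasoning.Setoid as SetoidReasoning
open import Relation.Nullary using (¬_; ¬?; yes; no; _×-dec_; _⊎-dec_; contradiction)
open import Relation.Nullary.Decidable using (⌊_⌋; fromWitness; toWitness)
open import Relation.Unary using (Decidable)

open import Defs hiding (sym)

private
  variable
    A B : Set
    x y : A
    xs ys zs : List A

Unique-resp-⊆ : xs ⊆ ys → Unique ys → Unique xs
Unique-resp-⊆ []         []       = []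
Unique-resp-⊆ (_ ∷ʳ p)   (_ ∷ u)  = Unique-resp-⊆ p u
Unique-resp-⊆ (refl ∷ p) (x≢ ∷ u) = All-resp-⊆ p x≢ ∷ Unique-resp-⊆ p u

∼set⇒≡ : Unique zs → xs ⊆ zs → ys ⊆ zs → xs ∼[ set ] ys → xs ≡ ys
∼set⇒≡ []       []         []         _  = refl
∼set⇒≡ (_ ∷ u)  (_ ∷ʳ p)   (_ ∷ʳ q)   eq = ∼set⇒≡ u p q eq
∼set⇒≡ (z≢ ∷ _) (_ ∷ʳ p)   (refl ∷ _) eq = contradiction (lookup p (Equivalence.from eq (here refl))) (All¬⇒¬Any z≢)
∼set⇒≡ (z≢ ∷ _) (refl ∷ _) (_ ∷ʳ q)   eq = contradiction (lookup q (Equivalence.to eq (here refl))) (All¬⇒¬Any z≢)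
∼set⇒≡ (z≢ ∷ u) (refl ∷ p) (refl ∷ q) eq =
  cong (_ ∷_) (∼set⇒≡ u p q (mk⇔ (drop-head p (Equivalence.to eq)) (drop-head q (Equivalence.from eq))))
  where
  drop-head : ∀ {ws vs} → ws ⊆ _ → (∀ {v} → v ∈ _ ∷ ws → v ∈ _ ∷ vs) → ∀ {v} → v ∈ ws → v ∈ vs
  drop-head r f v∈ with f (there v∈)
  ... | here refl = contradiction (lookup r v∈) (All¬⇒¬Any z≢)
  ... | there v∈′ = v∈′

injectiveOn⇒Unique-map : {f : A → B} → (∀ {x y} → x ∈ xs → y ∈ xs → f x ≡ f y → x ≡ y) →
                         Unique xs → Unique (map f xs)
injectiveOn⇒Unique-map _   []       = []
injectiveOn⇒Unique-map inj (x≢ ∷ u) =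
  All-map⁺ (All.tabulate λ y∈ fx≡fy → All.lookup x≢ y∈ (inj (here refl) (there y∈) fx≡fy))
  ∷ injectiveOn⇒Unique-map (λ x∈ y∈ → inj (there x∈) (there y∈)) u

inverseOn⇒length-≡ : {f : A → B} {g : B → A} → Unique xs → Unique ys →
  (∀ {x} → x ∈ xs → f x ∈ ys) → (∀ {y} → y ∈ ys → g y ∈ xs) →
  (∀ {x} → x ∈ xs → g (f x) ≡ x) → (∀ {y} → y ∈ ys → f (g y) ≡ y) →
  length xs ≡ length ys
inverseOn⇒length-≡ {xs = xs} {ys} {f = f} {g} xs-unique ys-unique f∈ g∈ gf fg =
  ≡-trans (sym (length-map f xs))
          (↭-length (∼bag⇒↭ (unique∧set⇒bag (injectiveOn⇒Unique-map f-injective xs-unique) ys-unique map-f∼ys)))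
  where
  f-injective : ∀ {x x′} → x ∈ xs → x′ ∈ xs → f x ≡ f x′ → x ≡ x′
  f-injective x∈ x′∈ eq = ≡-trans (sym (gf x∈)) (≡-trans (cong g eq) (gf x′∈))
  map-f∼ys : map f xs ∼[ set ] ys
  map-f∼ys = mk⇔ (λ y∈ → let _ , x∈ , y≡fx = ∈-map⁻ f y∈ in subst (_∈ ys) (sym y≡fx) (f∈ x∈))
                 (λ y∈ → subst (_∈ map f xs) (fg y∈) (∈-map⁺ f (g∈ y∈)))

∈-choose⁺ : xs ⊆ ys → xs ∈ choose (length xs) ys
∈-choose⁺ {xs = []}    _          = here refl
∈-choose⁺ {xs = _ ∷ _} (y ∷ʳ p)   = ∈-++⁺ʳ (map (y ∷_) _) (∈-choose⁺ p)
∈-choose⁺ {xs = x ∷ _} (refl ∷ p) = ∈-++⁺ˡ (∈-map⁺ (x ∷_) (∈-choose⁺ p))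

∈-choose⁻ : ∀ k ys → xs ∈ choose k ys → xs ⊆ ys × length xs ≡ k
∈-choose⁻ zero    ys       (here refl) = minimum ys , refl
∈-choose⁻ (suc k) (y ∷ ys) xs∈ with ∈-++⁻ (map (y ∷_) (choose k ys)) xs∈
... | inj₁ xs∈₁ with _ , xs′∈ , refl ← ∈-map⁻ (y ∷_) xs∈₁ =
  let p , len = ∈-choose⁻ k ys xs′∈ in refl ∷ p , cong suc len
... | inj₂ xs∈₂ = let p , len = ∈-choose⁻ (suc k) ys xs∈₂ in y ∷ʳ p , len

Unique-choose : ∀ k → Unique xs → Unique (choose k xs)
Unique-choose zero    _  = [] ∷ []
Unique-choose (suc k) [] = []
Unique-choose {xs = x ∷ xs} (suc k) (x∉ ∷ u) =
  Unique.++⁺ (Unique.map⁺ ∷-injectiveʳ (Unique-choose k u)) (Unique-choose (suc k) u) disjoint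
  where
  disjoint : ∀ {s} → ¬ (s ∈ map (x ∷_) (choose k xs) × s ∈ choose (suc k) xs)
  disjoint (s∈₁ , s∈₂) =
    let _ , _ , s≡x∷t = ∈-map⁻ (x ∷_) s∈₁
        p , _ = ∈-choose⁻ (suc k) xs s∈₂
    in All¬⇒¬Any x∉ (lookup p (subst (x ∈_) (sym s≡x∷t) (here refl)))

insertions-↭ : ∀ (x : A) ys → zs ∈ insertions x ys → zs ↭ x ∷ ys
insertions-↭ x []       (here refl) = refl
insertions-↭ x (y ∷ ys) (here refl) = refl
insertions-↭ x (y ∷ ys) (there zs∈) with _ , zs′∈ , refl ← ∈-map⁻ (y ∷_) zs∈ =
  trans (prep y (insertions-↭ x ys zs′∈)) (swap y x refl)

∈-insertions : ∀ (x : A) ys zs → ys ++ x ∷ zs ∈ insertions x (ys ++ zs)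
∈-insertions x []       []      = here refl
∈-insertions x []       (_ ∷ _) = here refl
∈-insertions x (y ∷ ys) zs      = there (∈-map⁺ (y ∷_) (∈-insertions x ys zs))

∈-perms⁻ : ∀ ys → xs ∈ perms ys → xs ↭ ys
∈-perms⁻ []       (here refl) = refl
∈-perms⁻ (y ∷ ys) xs∈ =
  let xs′ , xs′∈ , xs∈ins = find (∈-concatMap⁻ (insertions y) {perms ys} xs∈)
  in trans (insertions-↭ y xs′ xs∈ins) (prep y (∈-perms⁻ ys xs′∈))

∈-perms⁺ : ∀ ys → xs ↭ ys → xs ∈ perms ys
∈-perms⁺ []       p with refl ← ↭-empty-inv p = here refl
∈-perms⁺ (y ∷ ys) p with ws , zs , refl ← ∈-∃++ (∈-resp-↭ (↭-sym p) (here refl)) =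
  ∈-concatMap⁺ (insertions y) (lose (∈-perms⁺ ys (drop-mid ws [] p)) (∈-insertions y ws zs))

third-element : Unique xs → length xs ≡ 3 → x ∈ xs → y ∈ xs → ∃ λ z → z ∈ xs × z ≢ x × z ≢ y
third-element {xs = _ ∷ _ ∷ _ ∷ []} ((a≢b ∷ a≢c ∷ []) ∷ (b≢c ∷ []) ∷ _) refl x∈ y∈ with x∈ | y∈
... | here refl                 | here refl                 = _ , there (here refl) , ≢-sym a≢b , ≢-sym a≢b
... | here refl                 | there (here refl)         = _ , there (there (here refl)) , ≢-sym a≢c , ≢-sym b≢c
... | here refl                 | there (there (here refl)) = _ , there (here refl) , ≢-sym a≢b , b≢c
... | there (here refl)         | here refl                 = _ , there (there (here refl)) , ≢-sym b≢c , ≢-sym a≢c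
... | there (here refl)         | there (here refl)         = _ , here refl , a≢b , a≢b
... | there (here refl)         | there (there (here refl)) = _ , here refl , a≢b , a≢c
... | there (there (here refl)) | here refl                 = _ , there (here refl) , b≢c , ≢-sym a≢b
... | there (there (here refl)) | there (here refl)         = _ , here refl , a≢c , a≢b
... | there (there (here refl)) | there (there (here refl)) = _ , here refl , a≢c , a≢c

AtLeastTwo : (A → Set) → List A → Set
AtLeastTwo P xs = Any (λ x → Any (λ y → x ≢ y × P x × P y) xs) xs

atLeastTwo? : DecidableEquality A → {P : A → Set} → Decidable P → Decidable (AtLeastTwo P)
atLeastTwo? _≟_ P? xs = any? (λ x → any? (λ y → ¬? (x ≟ y) ×-dec P? x ×-dec P? y) xs) xs

module _ {P : A → Set} where

  atLeastTwo⁺ : x ∈ xs → y ∈ xs → x ≢ y → P x → P y → AtLeastTwo P xs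
  atLeastTwo⁺ x∈ y∈ x≢y px py = lose x∈ (lose y∈ (x≢y , px , py))

  atLeastTwo⁻ : AtLeastTwo P xs → ∃₂ λ x y → x ∈ xs × y ∈ xs × x ≢ y × P x × P y
  atLeastTwo⁻ h =
    let x , x∈ , h′ = find h
        y , y∈ , x≢y , px , py = find h′
    in x , y , x∈ , y∈ , x≢y , px , py

-- Induced pentagons of a Boolean relation

∧-true⁻ : ∀ {b c} → b ∧ c ≡ true → b ≡ true × c ≡ true
∧-true⁻ {true} h = refl , h

not-true⁻ : ∀ {b} → not b ≡ true → b ≡ false
not-true⁻ {false} _ = refl

≡true⇒≢false : ∀ {b} → b ≡ true → b ≢ false
≡true⇒≢false refl ()

pentagon : A → A → A → A → A → List A
pentagon a b c d e = a ∷ b ∷ c ∷ d ∷ e ∷ []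

pentagon-cong : ∀ {a b c d e a′ b′ c′ d′ e′ : A} → a ≡ a′ → b ≡ b′ → c ≡ c′ → d ≡ d′ → e ≡ e′ →
                pentagon a b c d e ≡ pentagon a′ b′ c′ d′ e′
pentagon-cong refl refl refl refl refl = refl

∈-rotate : ∀ {a b c d e : A} → x ∈ pentagon a b c d e → x ∈ pentagon b c d e a
∈-rotate (here refl)                                 = there (there (there (there (here refl))))
∈-rotate (there (here refl))                         = here refl
∈-rotate (there (there (here refl)))                 = there (here refl)
∈-rotate (there (there (there (here refl))))         = there (there (here refl))
∈-rotate (there (there (there (there (here refl))))) = there (there (there (here refl)))

pentagon-rotate : ∀ {a b c d e : A} → pentagon a b c d e ∼[ set ] pentagon b c d e a
pentagon-rotate = mk⇔ ∈-rotate (∈-rotate ∘ ∈-rotate ∘ ∈-rotate ∘ ∈-rotate)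

record C5 (R : A → A → Bool) (a b c d e : A) : Set where
  field
    ab : R a b ≡ true
    bc : R b c ≡ true
    cd : R c d ≡ true
    de : R d e ≡ true
    ea : R e a ≡ true
    ac : R a c ≡ false
    ad : R a d ≡ false
    bd : R b d ≡ false
    be : R b e ≡ false
    ce : R c e ≡ false

module _ {R : A → A → Bool} {a b c d e : A} where

  isInducedC5Order⇒C5 : isInducedC5Order R (pentagon a b c d e) ≡ true → C5 R a b c d e
  isInducedC5Order⇒C5 h =
    let ab , h = ∧-true⁻ h
        bc , h = ∧-true⁻ h
        cd , h = ∧-true⁻ h
        de , h = ∧-true⁻ h
        ea , h = ∧-true⁻ h
        ac , h = ∧-true⁻ h
        ad , h = ∧-true⁻ h
        bd , h = ∧-true⁻ h
        be , ce = ∧-true⁻ h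
    in record { ab = ab ; bc = bc ; cd = cd ; de = de ; ea = ea
              ; ac = not-true⁻ ac ; ad = not-true⁻ ad ; bd = not-true⁻ bd
              ; be = not-true⁻ be ; ce = not-true⁻ ce }

  C5⇒isInducedC5Order : C5 R a b c d e → isInducedC5Order R (pentagon a b c d e) ≡ true
  C5⇒isInducedC5Order h
    rewrite C5.ab h | C5.bc h | C5.cd h | C5.de h | C5.ea h
          | C5.ac h | C5.ad h | C5.bd h | C5.be h | C5.ce h = refl

record C5Ordering (R : A → A → Bool) (S : List A) : Set where
  field
    {a b c d e} : A
    cycle       : C5 R a b c d e
    elements    : S ∼[ set ] pentagon a b c d e

inducedC5s : List A → (A → A → Bool) → List (List A)
inducedC5s vs R = filter (λ S → T? (inducesC5 R S)) (choose 5 vs)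

∈-inducedC5s⁻ : ∀ {R : A → A → Bool} {S} vs → S ∈ inducedC5s vs R → S ⊆ vs × C5Ordering R S
∈-inducedC5s⁻ {R = R} {S} vs S∈ =
  let S∈choose , S-induces = ∈-filter⁻ (λ S → T? (inducesC5 R S)) S∈
      O , O∈perms , O-isC5 = find (any⁻ (isInducedC5Order R) (perms S) S-induces)
  in proj₁ (∈-choose⁻ 5 vs S∈choose) , ordering O (∈-perms⁻ S O∈perms) (Equivalence.to T-≡ O-isC5)
  where
  ordering : ∀ O → O ↭ S → isInducedC5Order R O ≡ true → C5Ordering R S
  ordering (a ∷ b ∷ c ∷ d ∷ e ∷ []) O↭S h = record
    { cycle    = isInducedC5Order⇒C5 h
    ; elements = mk⇔ (∈-resp-↭ (↭-sym O↭S)) (∈-resp-↭ O↭S) }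

module C5Properties {R : A → A → Bool}
  (R-sym : ∀ x y → R x y ≡ R y x) (R-irrefl : ∀ x → R x x ≡ false) where

  private
    variable
      a b c d e : A

  rotate : C5 R a b c d e → C5 R b c d e a
  rotate h = record
    { ab = bc ; bc = cd ; cd = de ; de = ea ; ea = ab
    ; ac = bd ; ad = be ; bd = ce ; be = ≡-trans (R-sym _ _) ac ; ce = ≡-trans (R-sym _ _) ad }
    where open C5 h

  distinct₁ : C5 R a b c d e → a ≢ b
  distinct₁ h refl = ≡true⇒≢false (C5.ab h) (R-irrefl _)

  distinct₂ : C5 R a b c d e → a ≢ c
  distinct₂ h refl = ≡true⇒≢false (C5.cd h) (C5.ad h)

  pentagon-unique : C5 R a b c d e → Unique (pentagon a b c d e)
  pentagon-unique h₀ =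
      (distinct₁ h₀ ∷ distinct₂ h₀ ∷ ≢-sym (distinct₂ h₃) ∷ ≢-sym (distinct₁ h₄) ∷ [])
    ∷ (distinct₁ h₁ ∷ distinct₂ h₁ ∷ ≢-sym (distinct₂ h₄) ∷ [])
    ∷ (distinct₁ h₂ ∷ distinct₂ h₂ ∷ [])
    ∷ (distinct₁ h₃ ∷ [])
    ∷ [] ∷ []
    where
    h₁ = rotate h₀
    h₂ = rotate h₁
    h₃ = rotate h₂
    h₄ = rotate h₃

  module _ {P : A → A → Set} (P-sym : ∀ {x y} → P x y → P y x) where

    private
      adjacent-elim₀ : C5 R a b c d e → P a b → P e a → y ∈ pentagon a b c d e → R a y ≡ true → P a y
      adjacent-elim₀ h pab pea (here refl) r = contradiction (R-irrefl _) (≡true⇒≢false r)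
      adjacent-elim₀ h pab pea (there (here refl)) r = pab
      adjacent-elim₀ h pab pea (there (there (here refl))) r = contradiction (C5.ac h) (≡true⇒≢false r)
      adjacent-elim₀ h pab pea (there (there (there (here refl)))) r = contradiction (C5.ad h) (≡true⇒≢false r)
      adjacent-elim₀ h pab pea (there (there (there (there (here refl))))) r = P-sym pea

    adjacent-elim : C5 R a b c d e → P a b → P b c → P c d → P d e → P e a →
                    x ∈ pentagon a b c d e → y ∈ pentagon a b c d e → R x y ≡ true → P x y
    adjacent-elim h pab pbc pcd pde pea (here refl) y∈ =
      adjacent-elim₀ h pab pea y∈
    adjacent-elim h pab pbc pcd pde pea (there (here refl)) y∈ =
      adjacent-elim₀ (rotate h) pbc pab (∈-rotate y∈)
    adjacent-elim h pab pbc pcd pde pea (there (there (here refl))) y∈ =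
      adjacent-elim₀ (rotate (rotate h)) pcd pbc (∈-rotate (∈-rotate y∈))
    adjacent-elim h pab pbc pcd pde pea (there (there (there (here refl)))) y∈ =
      adjacent-elim₀ (rotate (rotate (rotate h))) pde pcd (∈-rotate (∈-rotate (∈-rotate y∈)))
    adjacent-elim h pab pbc pcd pde pea (there (there (there (there (here refl))))) y∈ =
      adjacent-elim₀ (rotate (rotate (rotate (rotate h)))) pea pde (∈-rotate (∈-rotate (∈-rotate (∈-rotate y∈))))

  ∈-inducedC5s⁺ : ∀ {S vs} → Unique vs → S ⊆ vs → C5 R a b c d e → S ∼[ set ] pentagon a b c d e →
                  S ∈ inducedC5s vs R
  ∈-inducedC5s⁺ {S = S} {vs} vs-unique S⊆ h S∼ =
    let S↭O = ∼bag⇒↭ (unique∧set⇒bag (Unique-resp-⊆ S⊆ vs-unique) (pentagon-unique h) S∼)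
    in ∈-filter⁺ (λ S → T? (inducesC5 R S))
         (subst (λ k → S ∈ choose k vs) (↭-length S↭O) (∈-choose⁺ S⊆))
         (any⁺ (isInducedC5Order R)
               (lose (∈-perms⁺ S (↭-sym S↭O)) (Equivalence.from T-≡ (C5⇒isInducedC5Order h))))

-- Adjacency in the triangle graph

module _ {n : ℕ} where

  private
    variable
      t s : List (Fin n)

  shareVertex⁺ : x ∈ t → x ∈ s → shareVertex t s ≡ true
  shareVertex⁺ {t = y ∷ t} (here refl) x∈s
    rewrite Equivalence.to T-≡ (any⁺ (λ z → ⌊ y ≟F z ⌋) (Any.map fromWitness x∈s)) = refl
  shareVertex⁺ {t = y ∷ t} (there x∈t) x∈s =
    ≡-trans (cong (_ ∨_) (shareVertex⁺ x∈t x∈s)) (∨-zeroʳ _)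

  shareVertex⁻ : shareVertex t s ≡ true → ∃ λ x → x ∈ t × x ∈ s
  shareVertex⁻ {t = y ∷ t} {s = s} h with any (λ z → ⌊ y ≟F z ⌋) s in y∈s
  ... | true  = y , here refl , Any.map toWitness (any⁻ _ s (Equivalence.from T-≡ y∈s))
  ... | false = let x , x∈t , x∈s = shareVertex⁻ h in x , there x∈t , x∈s

  triAdj⁺ : t ≢ s → x ∈ t → x ∈ s → triAdj t s ≡ true
  triAdj⁺ {t = t} {s = s} t≢s x∈t x∈s with ≡-dec _≟F_ t s
  ... | yes t≡s = contradiction t≡s t≢s
  ... | no _    = shareVertex⁺ x∈t x∈s

  triAdj⁻ : ∀ t s → triAdj t s ≡ true → t ≢ s × ∃ λ x → x ∈ t × x ∈ s
  triAdj⁻ t s h with ≡-dec _≟F_ t s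
  ... | no t≢s = t≢s , shareVertex⁻ h

triAdj-irrefl : ∀ {n} (t : List (Fin n)) → triAdj t t ≡ false
triAdj-irrefl t with ≡-dec _≟F_ t t
... | yes _  = refl
... | no t≢t = contradiction refl t≢t

triAdj-sym : ∀ {n} (t s : List (Fin n)) → triAdj t s ≡ triAdj s t
triAdj-sym t s = ⇔→≡ (mk⇔ (flip t s) (flip s t))
  where
  flip : ∀ t s → triAdj t s ≡ true → triAdj s t ≡ true
  flip t s h = let t≢s , _ , x∈t , x∈s = triAdj⁻ t s h in triAdj⁺ (≢-sym t≢s) x∈s x∈t

-- Locally linear graphs

module LocallyLinearGraph {n : ℕ} (G : Graph n) (G-ll : LocallyLinear G) where

  open DecMembership (_≟F_ {n}) using (_∈?_)

  V : List (Fin n)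
  V = allFin n

  V-unique : Unique V
  V-unique = Unique.allFin⁺ n

  _~_ : Fin n → Fin n → Set
  x ~ y = adj G x y ≡ true

  private
    variable
      a b c d e u v w z : Fin n
      t t′ : List (Fin n)

  ~-sym : x ~ y → y ~ x
  ~-sym {x} {y} x~y = ≡-trans (Graph.sym G y x) x~y

  ~⇒≢ : x ~ y → x ≢ y
  ~⇒≢ x~x refl = ≡true⇒≢false x~x (irrefl G _)

  commonNeighbour-unique : x ~ y → x ~ z → y ~ z → x ~ w → y ~ w → z ≡ w
  commonNeighbour-unique {x} {y} x~y x~z y~z x~w y~w =
    let _ , _ , unique = proj₂ G-ll x y x~y
    in ≡-trans (unique _ x~z y~z) (sym (unique _ x~w y~w))

  Clique : List (Fin n) → Set
  Clique t = ∀ {x y} → x ∈ t → y ∈ t → x ≢ y → x ~ y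

  clique₃ : x ~ y → y ~ z → x ~ z → Clique (x ∷ y ∷ z ∷ [])
  clique₃ x~y y~z x~z (here refl)                 (here refl)                 x≢x = contradiction refl x≢x
  clique₃ x~y y~z x~z (here refl)                 (there (here refl))         _   = x~y
  clique₃ x~y y~z x~z (here refl)                 (there (there (here refl))) _   = x~z
  clique₃ x~y y~z x~z (there (here refl))         (here refl)                 _   = ~-sym x~y
  clique₃ x~y y~z x~z (there (here refl))         (there (here refl))         y≢y = contradiction refl y≢y
  clique₃ x~y y~z x~z (there (here refl))         (there (there (here refl))) _   = y~z
  clique₃ x~y y~z x~z (there (there (here refl))) (here refl)                 _   = ~-sym x~z
  clique₃ x~y y~z x~z (there (there (here refl))) (there (here refl))         _   = ~-sym y~z
  clique₃ x~y y~z x~z (there (there (here refl))) (there (there (here refl))) z≢z = contradiction refl z≢z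

  Δ : List (List (Fin n))
  Δ = triangles G

  Δ-unique : Unique Δ
  Δ-unique = Unique.filter⁺ _ (Unique-choose 3 V-unique)

  isTriangle⇒Clique : ∀ t → isTriangle G t ≡ true → Clique t
  isTriangle⇒Clique (x ∷ y ∷ z ∷ []) h =
    let x~y , h′ = ∧-true⁻ h
        y~z , x~z = ∧-true⁻ h′
    in clique₃ x~y y~z x~z

  Clique⇒isTriangle : ∀ t → Unique t → length t ≡ 3 → Clique t → isTriangle G t ≡ true
  Clique⇒isTriangle (x ∷ y ∷ z ∷ []) ((x≢y ∷ x≢z ∷ []) ∷ (y≢z ∷ []) ∷ _) refl cl
    rewrite cl (here refl) (there (here refl)) x≢y
          | cl (there (here refl)) (there (there (here refl))) y≢z
          | cl (here refl) (there (there (here refl))) x≢z = refl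

  ∈-triangles⁻ : t ∈ Δ → t ⊆ V × Unique t × length t ≡ 3 × Clique t
  ∈-triangles⁻ {t} t∈ =
    let t∈choose , t-isTriangle = ∈-filter⁻ (λ t → T? (isTriangle G t)) t∈
        t⊆ , t-length = ∈-choose⁻ 3 V t∈choose
    in t⊆ , Unique-resp-⊆ t⊆ V-unique , t-length , isTriangle⇒Clique t (Equivalence.to T-≡ t-isTriangle)

  ∈-triangles⁺ : t ⊆ V → length t ≡ 3 → Clique t → t ∈ Δ
  ∈-triangles⁺ {t} t⊆ t-length cl =
    ∈-filter⁺ (λ t → T? (isTriangle G t))
      (subst (λ k → t ∈ choose k V) t-length (∈-choose⁺ t⊆))
      (Equivalence.from T-≡ (Clique⇒isTriangle t (Unique-resp-⊆ t⊆ V-unique) t-length cl))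

  triangle-clique : t ∈ Δ → Clique t
  triangle-clique t∈ = proj₂ (proj₂ (proj₂ (∈-triangles⁻ t∈)))

  tri-vertex? : ∀ x y → Decidable (λ z → z ≡ x ⊎ z ≡ y ⊎ (x ~ z × y ~ z))
  tri-vertex? x y z = z ≟F x ⊎-dec z ≟F y ⊎-dec (adj G x z ≟B true ×-dec adj G y z ≟B true)

  tri : Fin n → Fin n → List (Fin n)
  tri x y = filter (tri-vertex? x y) V

  ∈-tri⁺ : z ≡ x ⊎ z ≡ y ⊎ (x ~ z × y ~ z) → z ∈ tri x y
  ∈-tri⁺ {x = x} {y} = ∈-filter⁺ (tri-vertex? x y) (∈-allFin _)

  ∈-tri⁻ : z ∈ tri x y → z ≡ x ⊎ z ≡ y ⊎ (x ~ z × y ~ z)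
  ∈-tri⁻ {x = x} {y} = proj₂ ∘ ∈-filter⁻ (tri-vertex? x y) {xs = V}

  tri-∋ˡ : x ∈ tri x y
  tri-∋ˡ = ∈-tri⁺ (inj₁ refl)

  tri-∋ʳ : y ∈ tri x y
  tri-∋ʳ = ∈-tri⁺ (inj₂ (inj₁ refl))

  tri∈Δ : x ~ y → tri x y ∈ Δ
  tri∈Δ {x} {y} x~y with w , (x~w , y~w) , _ ← proj₂ G-ll x y x~y =
    ∈-triangles⁺ (filter-⊆ _ V) (↭-length tri↭xyw) (λ u∈ v∈ → clique₃ x~y y~w x~w (to u∈) (to v∈))
    where
    to : z ∈ tri x y → z ∈ x ∷ y ∷ w ∷ []
    to z∈ with ∈-tri⁻ z∈
    ... | inj₁ refl               = here refl
    ... | inj₂ (inj₁ refl)        = there (here refl)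
    ... | inj₂ (inj₂ (x~z , y~z)) = there (there (here (commonNeighbour-unique x~y x~z y~z x~w y~w)))
    from : z ∈ x ∷ y ∷ w ∷ [] → z ∈ tri x y
    from (here refl)                 = tri-∋ˡ
    from (there (here refl))         = tri-∋ʳ
    from (there (there (here refl))) = ∈-tri⁺ (inj₂ (inj₂ (x~w , y~w)))
    xyw-unique : Unique (x ∷ y ∷ w ∷ [])
    xyw-unique = (~⇒≢ x~y ∷ ~⇒≢ x~w ∷ []) ∷ (~⇒≢ y~w ∷ []) ∷ [] ∷ []
    tri↭xyw : tri x y ↭ x ∷ y ∷ w ∷ []
    tri↭xyw = ∼bag⇒↭ (unique∧set⇒bag (Unique.filter⁺ _ V-unique) xyw-unique (mk⇔ to from))

  triangle≡tri : t ∈ Δ → x ∈ t → y ∈ t → x ≢ y → t ≡ tri x y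
  triangle≡tri {t} {x} {y} t∈ x∈ y∈ x≢y with t⊆ , t-unique , t-length , cl ← ∈-triangles⁻ t∈ =
    ∼set⇒≡ V-unique t⊆ (filter-⊆ _ V) (mk⇔ to from)
    where
    to : z ∈ t → z ∈ tri x y
    to {z} z∈ with z ≟F x | z ≟F y
    ... | yes z≡x | _       = ∈-tri⁺ (inj₁ z≡x)
    ... | no _    | yes z≡y = ∈-tri⁺ (inj₂ (inj₁ z≡y))
    ... | no z≢x  | no z≢y  = ∈-tri⁺ (inj₂ (inj₂ (cl x∈ z∈ (≢-sym z≢x) , cl y∈ z∈ (≢-sym z≢y))))
    from : z ∈ tri x y → z ∈ t
    from z∈ with ∈-tri⁻ z∈
    ... | inj₁ refl               = x∈
    ... | inj₂ (inj₁ refl)        = y∈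
    ... | inj₂ (inj₂ (x~z , y~z)) =
      let w , w∈ , w≢x , w≢y = third-element t-unique t-length x∈ y∈
          z≡w = commonNeighbour-unique (cl x∈ y∈ x≢y) x~z y~z (cl x∈ w∈ (≢-sym w≢x)) (cl y∈ w∈ (≢-sym w≢y))
      in subst (_∈ t) (sym z≡w) w∈

  onEdge : x ~ y → t ∈ Δ → x ∈ t → y ∈ t → t ≡ tri x y
  onEdge x~y t∈ x∈ y∈ = triangle≡tri t∈ x∈ y∈ (~⇒≢ x~y)

  triangles-meet-once : t ∈ Δ → t′ ∈ Δ → x ≢ y → x ∈ t → y ∈ t → x ∈ t′ → y ∈ t′ → t ≡ t′
  triangles-meet-once t∈ t′∈ x≢y x∈t y∈t x∈t′ y∈t′ =
    ≡-trans (triangle≡tri t∈ x∈t y∈t x≢y) (sym (triangle≡tri t′∈ x∈t′ y∈t′ x≢y))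

  meet : ∀ t t′ → triAdj t t′ ≡ true → Fin n
  meet t t′ h = proj₁ (proj₂ (triAdj⁻ t t′ h))

  meet-∈ˡ : ∀ t t′ (h : triAdj t t′ ≡ true) → meet t t′ h ∈ t
  meet-∈ˡ t t′ h = proj₁ (proj₂ (proj₂ (triAdj⁻ t t′ h)))

  meet-∈ʳ : ∀ t t′ (h : triAdj t t′ ≡ true) → meet t t′ h ∈ t′
  meet-∈ʳ t t′ h = proj₂ (proj₂ (proj₂ (triAdj⁻ t t′ h)))

  meet-unique : t ∈ Δ → t′ ∈ Δ → (h : triAdj t t′ ≡ true) → v ∈ t → v ∈ t′ → v ≡ meet t t′ h
  meet-unique {t} {t′} {v} t∈ t′∈ h v∈t v∈t′ with v ≟F meet t t′ h
  ... | yes v≡ = v≡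
  ... | no v≢  = contradiction (triangles-meet-once t∈ t′∈ v≢ v∈t (meet-∈ˡ t t′ h) v∈t′ (meet-∈ʳ t t′ h))
                              (proj₁ (triAdj⁻ t t′ h))

  module C5ᴳ = C5Properties (Graph.sym G) (irrefl G)
  module C5* = C5Properties (triAdj-sym {n}) triAdj-irrefl

  tri-adjacent : C5 (adj G) a b c d e → triAdj (tri a b) (tri b c) ≡ true
  tri-adjacent {a} {b} {c} h = triAdj⁺ tri-ab≢tri-bc tri-∋ʳ tri-∋ˡ
    where
    tri-ab≢tri-bc : tri a b ≢ tri b c
    tri-ab≢tri-bc eq with ∈-tri⁻ (subst (c ∈_) (sym eq) tri-∋ʳ)
    ... | inj₁ c≡a              = C5ᴳ.distinct₂ h (sym c≡a)
    ... | inj₂ (inj₁ c≡b)       = C5ᴳ.distinct₁ (C5ᴳ.rotate h) (sym c≡b)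
    ... | inj₂ (inj₂ (a~c , _)) = ≡true⇒≢false a~c (C5.ac h)

  tri-nonadjacent : C5 (adj G) a b c d e → triAdj (tri a b) (tri c d) ≡ false
  tri-nonadjacent {a} {b} {c} {d} h = ¬-not λ adjacent →
    let _ , _ , u∈ab , u∈cd = triAdj⁻ (tri a b) (tri c d) adjacent
    in common-vertex (∈-tri⁻ u∈ab) (∈-tri⁻ u∈cd)
    where
    open C5 h
    h₁ = C5ᴳ.rotate h
    h₃ = C5ᴳ.rotate (C5ᴳ.rotate h₁)
    common-vertex : u ≡ a ⊎ u ≡ b ⊎ (a ~ u × b ~ u) → u ≡ c ⊎ u ≡ d ⊎ (c ~ u × d ~ u) → ⊥
    common-vertex (inj₁ refl)        (inj₁ a≡c)              = C5ᴳ.distinct₂ h a≡c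
    common-vertex (inj₁ refl)        (inj₂ (inj₁ a≡d))       = C5ᴳ.distinct₂ h₃ (sym a≡d)
    common-vertex (inj₁ refl)        (inj₂ (inj₂ (c~a , _))) = ≡true⇒≢false (~-sym c~a) ac
    common-vertex (inj₂ (inj₁ refl)) (inj₁ b≡c)              = C5ᴳ.distinct₁ h₁ b≡c
    common-vertex (inj₂ (inj₁ refl)) (inj₂ (inj₁ b≡d))       = C5ᴳ.distinct₂ h₁ b≡d
    common-vertex (inj₂ (inj₁ refl)) (inj₂ (inj₂ (_ , d~b))) = ≡true⇒≢false (~-sym d~b) bd
    common-vertex (inj₂ (inj₂ (a~c , _)))   (inj₁ refl)        = ≡true⇒≢false a~c ac
    common-vertex (inj₂ (inj₂ (_ , b~d)))   (inj₂ (inj₁ refl)) = ≡true⇒≢false b~d bd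
    -- a and c would both be the third vertex of the triangle on the edge b u.
    common-vertex (inj₂ (inj₂ (a~u , b~u))) (inj₂ (inj₂ (c~u , _))) =
      C5ᴳ.distinct₂ h (commonNeighbour-unique b~u (~-sym ab) (~-sym a~u) bc (~-sym c~u))

  tri-C5 : C5 (adj G) a b c d e → C5 triAdj (tri a b) (tri b c) (tri c d) (tri d e) (tri e a)
  tri-C5 {a} {b} {c} {d} {e} h₀ = record
    { ab = tri-adjacent h₀ ; bc = tri-adjacent h₁ ; cd = tri-adjacent h₂
    ; de = tri-adjacent h₃ ; ea = tri-adjacent h₄
    ; ac = tri-nonadjacent h₀
    ; ad = ≡-trans (triAdj-sym (tri a b) (tri d e)) (tri-nonadjacent h₃)
    ; bd = tri-nonadjacent h₁
    ; be = ≡-trans (triAdj-sym (tri b c) (tri e a)) (tri-nonadjacent h₄)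
    ; ce = tri-nonadjacent h₂ }
    where
    h₁ = C5ᴳ.rotate h₀
    h₂ = C5ᴳ.rotate h₁
    h₃ = C5ᴳ.rotate h₂
    h₄ = C5ᴳ.rotate h₃

  edgeTriangles : List (Fin n) → List (List (Fin n))
  edgeTriangles S = filter (λ t → atLeastTwo? _≟F_ (_∈? t) S) Δ

  sharedVertices : List (List (Fin n)) → List (Fin n)
  sharedVertices S* = filter (λ v → atLeastTwo? (≡-dec _≟F_) (v ∈?_) S*) V

  edgeTriangles-pentagon : C5 (adj G) a b c d e → ∀ {S} → S ∼[ set ] pentagon a b c d e →
    edgeTriangles S ∼[ set ] pentagon (tri a b) (tri b c) (tri c d) (tri d e) (tri e a)
  edgeTriangles-pentagon {a} {b} {c} {d} {e} h {S} S∼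
    with a∈ ∷ b∈ ∷ c∈ ∷ d∈ ∷ e∈ ∷ [] ← All.tabulate {P = _∈ S} (Equivalence.from S∼) = mk⇔ to from
    where
    open C5 h
    Listed : Fin n → Fin n → Set
    Listed x y = ∀ {t} → t ∈ Δ → x ∈ t → y ∈ t → t ∈ pentagon (tri a b) (tri b c) (tri c d) (tri d e) (tri e a)
    listed-sym : Listed x y → Listed y x
    listed-sym listed t∈ y∈ x∈ = listed t∈ x∈ y∈
    to : t ∈ edgeTriangles S → t ∈ pentagon (tri a b) (tri b c) (tri c d) (tri d e) (tri e a)
    to t∈ =
      let t∈Δ , two = ∈-filter⁻ (λ t → atLeastTwo? _≟F_ (_∈? t) S) t∈
          _ , _ , x∈S , y∈S , x≢y , x∈t , y∈t = atLeastTwo⁻ two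
      in C5ᴳ.adjacent-elim listed-sym h
           (λ t∈ a∈ b∈ → here (onEdge ab t∈ a∈ b∈))
           (λ t∈ b∈ c∈ → there (here (onEdge bc t∈ b∈ c∈)))
           (λ t∈ c∈ d∈ → there (there (here (onEdge cd t∈ c∈ d∈))))
           (λ t∈ d∈ e∈ → there (there (there (here (onEdge de t∈ d∈ e∈)))))
           (λ t∈ e∈ a∈ → there (there (there (there (here (onEdge ea t∈ e∈ a∈))))))
           (Equivalence.to S∼ x∈S) (Equivalence.to S∼ y∈S) (triangle-clique t∈Δ x∈t y∈t x≢y) t∈Δ x∈t y∈t
    on-edge : x ~ y → x ∈ S → y ∈ S → tri x y ∈ edgeTriangles S
    on-edge x~y x∈ y∈ = ∈-filter⁺ _ (tri∈Δ x~y) (atLeastTwo⁺ x∈ y∈ (~⇒≢ x~y) tri-∋ˡ tri-∋ʳ)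
    from : t ∈ pentagon (tri a b) (tri b c) (tri c d) (tri d e) (tri e a) → t ∈ edgeTriangles S
    from (here refl)                                 = on-edge ab a∈ b∈
    from (there (here refl))                         = on-edge bc b∈ c∈
    from (there (there (here refl)))                 = on-edge cd c∈ d∈
    from (there (there (there (here refl))))         = on-edge de d∈ e∈
    from (there (there (there (there (here refl))))) = on-edge ea e∈ a∈

  meet-adjacent : ∀ {A B C D E} (h : C5 triAdj A B C D E) → B ∈ Δ → meet A B (C5.ab h) ~ meet B C (C5.bc h)
  meet-adjacent {A} {B} {C} h B∈ = triangle-clique B∈ (meet-∈ʳ A B ab) (meet-∈ˡ B C bc) distinct
    where
    open C5 h
    distinct : meet A B ab ≢ meet B C bc
    distinct eq = ≡true⇒≢false
      (triAdj⁺ (C5*.distinct₂ h) (meet-∈ˡ A B ab) (subst (_∈ C) (sym eq) (meet-∈ʳ B C bc))) ac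

  meet-nonadjacent : ∀ {A B C D E} (h : C5 triAdj A B C D E) → B ∈ Δ → C ∈ Δ →
                     adj G (meet A B (C5.ab h)) (meet C D (C5.cd h)) ≡ false
  -- u₃ would lie on the triangle B of the edge u₁ u₂, and B would then meet D.
  meet-nonadjacent {A} {B} {C} {D} h B∈ C∈ = ¬-not λ u₁~u₃ →
    let u₃∈B = subst (u₃ ∈_) (sym (onEdge u₁~u₂ B∈ (meet-∈ʳ A B ab) (meet-∈ˡ B C bc)))
                     (∈-tri⁺ (inj₂ (inj₂ (u₁~u₃ , u₂~u₃))))
    in ≡true⇒≢false (triAdj⁺ (C5*.distinct₂ (C5*.rotate h)) u₃∈B (meet-∈ʳ C D cd)) bd
    where
    open C5 h
    u₁ = meet A B ab
    u₂ = meet B C bc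
    u₃ = meet C D cd
    u₁~u₂ : u₁ ~ u₂
    u₁~u₂ = meet-adjacent h B∈
    u₂~u₃ : u₂ ~ u₃
    u₂~u₃ = meet-adjacent (C5*.rotate h) C∈

  meets-C5 : ∀ {A B C D E} (h : C5 triAdj A B C D E) → All (_∈ Δ) (pentagon A B C D E) →
    C5 (adj G) (meet A B (C5.ab h)) (meet B C (C5.bc h)) (meet C D (C5.cd h))
               (meet D E (C5.de h)) (meet E A (C5.ea h))
  meets-C5 h₀ (A∈ ∷ B∈ ∷ C∈ ∷ D∈ ∷ E∈ ∷ []) = record
    { ab = meet-adjacent h₀ B∈ ; bc = meet-adjacent h₁ C∈ ; cd = meet-adjacent h₂ D∈
    ; de = meet-adjacent h₃ E∈ ; ea = meet-adjacent h₄ A∈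
    ; ac = meet-nonadjacent h₀ B∈ C∈
    ; ad = ≡-trans (Graph.sym G _ _) (meet-nonadjacent h₃ E∈ A∈)
    ; bd = meet-nonadjacent h₁ C∈ D∈
    ; be = ≡-trans (Graph.sym G _ _) (meet-nonadjacent h₄ A∈ B∈)
    ; ce = meet-nonadjacent h₂ D∈ E∈ }
    where
    h₁ = C5*.rotate h₀
    h₂ = C5*.rotate h₁
    h₃ = C5*.rotate h₂
    h₄ = C5*.rotate h₃

  sharedVertices-pentagon : ∀ {A B C D E} (h : C5 triAdj A B C D E) → All (_∈ Δ) (pentagon A B C D E) →
    ∀ {S*} → S* ∼[ set ] pentagon A B C D E →
    sharedVertices S* ∼[ set ] pentagon (meet A B (C5.ab h)) (meet B C (C5.bc h)) (meet C D (C5.cd h))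
                                        (meet D E (C5.de h)) (meet E A (C5.ea h))
  sharedVertices-pentagon {A} {B} {C} {D} {E} h (A∈ ∷ B∈ ∷ C∈ ∷ D∈ ∷ E∈ ∷ []) {S*} S*∼
    with A∈S* ∷ B∈S* ∷ C∈S* ∷ D∈S* ∷ E∈S* ∷ [] ← All.tabulate {P = _∈ S*} (Equivalence.from S*∼) = mk⇔ to from
    where
    open C5 h
    meets : List (Fin n)
    meets = pentagon (meet A B ab) (meet B C bc) (meet C D cd) (meet D E de) (meet E A ea)
    Listed : List (Fin n) → List (Fin n) → Set
    Listed t t′ = ∀ {v} → v ∈ t → v ∈ t′ → v ∈ meets
    listed-sym : Listed t t′ → Listed t′ t
    listed-sym listed v∈t′ v∈t = listed v∈t v∈t′
    to : v ∈ sharedVertices S* → v ∈ meets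
    to v∈ =
      let _ , two = ∈-filter⁻ (λ v → atLeastTwo? (≡-dec _≟F_) (v ∈?_) S*) {xs = V} v∈
          t , t′ , t∈ , t′∈ , t≢t′ , v∈t , v∈t′ = atLeastTwo⁻ two
      in C5*.adjacent-elim listed-sym h
           (λ v∈A v∈B → here (meet-unique A∈ B∈ ab v∈A v∈B))
           (λ v∈B v∈C → there (here (meet-unique B∈ C∈ bc v∈B v∈C)))
           (λ v∈C v∈D → there (there (here (meet-unique C∈ D∈ cd v∈C v∈D))))
           (λ v∈D v∈E → there (there (there (here (meet-unique D∈ E∈ de v∈D v∈E)))))
           (λ v∈E v∈A → there (there (there (there (here (meet-unique E∈ A∈ ea v∈E v∈A))))))
           (Equivalence.to S*∼ t∈) (Equivalence.to S*∼ t′∈) (triAdj⁺ t≢t′ v∈t v∈t′) v∈t v∈t′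
    shared : ∀ t t′ (adjacent : triAdj t t′ ≡ true) → t ∈ S* → t′ ∈ S* → meet t t′ adjacent ∈ sharedVertices S*
    shared t t′ adjacent t∈ t′∈ =
      ∈-filter⁺ _ (∈-allFin _) (atLeastTwo⁺ t∈ t′∈ (proj₁ (triAdj⁻ t t′ adjacent))
                                            (meet-∈ˡ t t′ adjacent) (meet-∈ʳ t t′ adjacent))
    from : v ∈ meets → v ∈ sharedVertices S*
    from (here refl)                                 = shared A B ab A∈S* B∈S*
    from (there (here refl))                         = shared B C bc B∈S* C∈S*
    from (there (there (here refl)))                 = shared C D cd C∈S* D∈S*
    from (there (there (there (here refl))))         = shared D E de D∈S* E∈S*
    from (there (there (there (there (here refl))))) = shared E A ea E∈S* A∈S*

  tri-pentagon-∈Δ : C5 (adj G) a b c d e → All (_∈ Δ) (pentagon (tri a b) (tri b c) (tri c d) (tri d e) (tri e a))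
  tri-pentagon-∈Δ h = tri∈Δ ab ∷ tri∈Δ bc ∷ tri∈Δ cd ∷ tri∈Δ de ∷ tri∈Δ ea ∷ []
    where open C5 h

  meet-tri : (h : C5 (adj G) a b c d e) → meet (tri a b) (tri b c) (tri-adjacent h) ≡ b
  meet-tri h = sym (meet-unique (tri∈Δ (C5.ab h)) (tri∈Δ (C5.bc h)) (tri-adjacent h) tri-∋ʳ tri-∋ˡ)

  sharedVertices∘edgeTriangles : ∀ {S} → S ∈ inducedC5s V (adj G) → sharedVertices (edgeTriangles S) ≡ S
  sharedVertices∘edgeTriangles {S} S∈
    with S⊆ , record { a = a ; b = b ; c = c ; d = d ; e = e ; cycle = h ; elements = S∼ } ← ∈-inducedC5s⁻ V S∈ =
    ∼set⇒≡ V-unique (filter-⊆ _ V) S⊆ (begin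
      sharedVertices (edgeTriangles S)
        ≈⟨ sharedVertices-pentagon (tri-C5 h) (tri-pentagon-∈Δ h) (edgeTriangles-pentagon h S∼) ⟩
      pentagon _ _ _ _ _
        ≡⟨ pentagon-cong (meet-tri h₀) (meet-tri h₁) (meet-tri h₂) (meet-tri h₃) (meet-tri h₄) ⟩
      pentagon b c d e a
        ≈⟨ pentagon-rotate ⟨
      pentagon a b c d e
        ≈⟨ S∼ ⟨
      S ∎)
    where
    open SetoidReasoning ([ set ]-Equality (Fin n))
    h₀ = h
    h₁ = C5ᴳ.rotate h₀
    h₂ = C5ᴳ.rotate h₁
    h₃ = C5ᴳ.rotate h₂
    h₄ = C5ᴳ.rotate h₃

  tri-meets : ∀ {A B C D E} (h : C5 triAdj A B C D E) → B ∈ Δ → tri (meet A B (C5.ab h)) (meet B C (C5.bc h)) ≡ B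
  tri-meets {A} {B} {C} h B∈ =
    sym (onEdge (meet-adjacent h B∈) B∈ (meet-∈ʳ A B (C5.ab h)) (meet-∈ˡ B C (C5.bc h)))

  edgeTriangles∘sharedVertices : ∀ {S*} → S* ∈ inducedC5s Δ triAdj → edgeTriangles (sharedVertices S*) ≡ S*
  edgeTriangles∘sharedVertices {S*} S*∈
    with S*⊆ , record { a = A ; b = B ; c = C ; d = D ; e = E ; cycle = h ; elements = S*∼ } ← ∈-inducedC5s⁻ Δ S*∈ =
    ∼set⇒≡ Δ-unique (filter-⊆ _ Δ) S*⊆ (begin
      edgeTriangles (sharedVertices S*)
        ≈⟨ edgeTriangles-pentagon (meets-C5 h (All.tabulate ∈Δ)) (sharedVertices-pentagon h (All.tabulate ∈Δ) S*∼) ⟩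
      pentagon _ _ _ _ _
        ≡⟨ pentagon-cong (tri-meets h₀ (∈Δ (there (here refl)))) (tri-meets h₁ (∈Δ (there (there (here refl)))))
                         (tri-meets h₂ (∈Δ (there (there (there (here refl))))))
                         (tri-meets h₃ (∈Δ (there (there (there (there (here refl)))))))
                         (tri-meets h₄ (∈Δ (here refl))) ⟩
      pentagon B C D E A
        ≈⟨ pentagon-rotate ⟨
      pentagon A B C D E
        ≈⟨ S*∼ ⟨
      S* ∎)
    where
    open SetoidReasoning ([ set ]-Equality (List (Fin n)))
    ∈Δ : t ∈ pentagon A B C D E → t ∈ Δ
    ∈Δ = lookup S*⊆ ∘ Equivalence.from S*∼
    h₀ = h
    h₁ = C5*.rotate h₀
    h₂ = C5*.rotate h₁
    h₃ = C5*.rotate h₂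
    h₄ = C5*.rotate h₃

  edgeTriangles-inducedC5 : ∀ {S} → S ∈ inducedC5s V (adj G) → edgeTriangles S ∈ inducedC5s Δ triAdj
  edgeTriangles-inducedC5 S∈ with _ , record { cycle = h ; elements = S∼ } ← ∈-inducedC5s⁻ V S∈ =
    C5*.∈-inducedC5s⁺ Δ-unique (filter-⊆ _ Δ) (tri-C5 h) (edgeTriangles-pentagon h S∼)

  sharedVertices-inducedC5 : ∀ {S*} → S* ∈ inducedC5s Δ triAdj → sharedVertices S* ∈ inducedC5s V (adj G)
  sharedVertices-inducedC5 S*∈ with S*⊆ , record { cycle = h ; elements = S*∼ } ← ∈-inducedC5s⁻ Δ S*∈ =
    C5ᴳ.∈-inducedC5s⁺ V-unique (filter-⊆ _ V) (meets-C5 h inΔ) (sharedVertices-pentagon h inΔ S*∼)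
    where
    inΔ = All.tabulate (lookup S*⊆ ∘ Equivalence.from S*∼)

proposition5 : ∀ (n : ℕ) (G : Graph n) → LocallyLinear G →
    countInducedC5 (allFin n) (adj G) ≡ countInducedC5 (triangles G) triAdj
proposition5 n G G-ll =
  inverseOn⇒length-≡
    (Unique.filter⁺ _ (Unique-choose 5 V-unique)) (Unique.filter⁺ _ (Unique-choose 5 Δ-unique))
    edgeTriangles-inducedC5 sharedVertices-inducedC5
    sharedVertices∘edgeTriangles edgeTriangles∘sharedVertices
  where open LocallyLinearGraph G G-ll
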